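{- Let $X$ be an equivalence class of Young graphs under isomorphism, and let $R_X(g,k)$ be the relation on integers $2\le k<g$ holding iff $Y(g,k)\in X$. The set of 1089 graphs is the only such equivalence class $X$ for which there is a fixed function $f:\mathbb{Z}^+\to\mathbb{Z}$ with $R_X(g,k)$ holding if and only if $f(k)\mid g$.
   Context: The labeled directed graph $H(g,k)$ ($2\le k<g$ integers) has a starting node $[[0,0]]$ and other nodes $[R,r]$, $0\le R,r\le k-1$ ($[0,0]$ distinct from the starting node); from a node $[P,p]$ (starting node treated as $[0,0]$) there is an edge labeled $(A,a)$ to $[R,r]$ whenever $0\le A,a\le g-1$, $ka+p=A+rg$, $kA+R=a+Pg$, with $A\ne0\ne a$ required for edges leaving the starting node, and no edges into the starting node; $H(g,k)$ consists of all nodes reachable from the starting node. Even pivot node: $[a,a]$; odd pivot node: $[r,s]$ with an edge to $[s,r]$; the starting node is not a pivot node. The Young graph $Y(g,k)$ is obtained from $H(g,k)$ by deleting every non-pivot node from which no pivot node is reachable. Two Young graphs are isomorphic if there is a bijection of node sets that is an isomorphism of the underlying unlabeled directed graphs and preserves being an even pivot node and being an odd pivot node. A 1089 graph is a Young graph isomorphic to $Y(10,9)$. -}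

module Defs where

open import Data.Nat using (ℕ; _+_; _*_; _<_; _≤_)
open import Data.Fin using (Fin; toℕ)
open import Data.Product using (Σ; _×_; ∃)
open import Data.Sum using (_⊎_)
open import Relation.Binary.PropositionalEquality using (_≡_; _≢_)
open import Relation.Binary.Construct.Closure.ReflexiveTransitive using (Star)
open import Function.Bundles using (_⇔_)

-- Nodes of H(g,k): the starting node [[0,0]] and the nodes [R,r], 0 ≤ R,r ≤ k-1.
data Node (k : ℕ) : Set where
  start : Node k
  node  : Fin k → Fin k → Node k

-- Labeled edge from [P,p] to [R,r] with label (A,a).
-- The starting node is treated as [0,0] but requires A ≠ 0 ≠ a;
-- there are no edges into the starting node.
data LEdge (g k : ℕ) : Node k → ℕ → ℕ → Node k → Set where
  fromStart : ∀ {A a R r} → A < g → a < g → A ≢ 0 → a ≢ 0 →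
              k * a + 0 ≡ A + toℕ r * g →
              k * A + toℕ R ≡ a + 0 * g →
              LEdge g k start A a (node R r)
  fromNode  : ∀ {P p A a R r} → A < g → a < g →
              k * a + toℕ p ≡ A + toℕ r * g →
              k * A + toℕ R ≡ a + toℕ P * g →
              LEdge g k (node P p) A a (node R r)

Edge : (g k : ℕ) → Node k → Node k → Set
Edge g k u v = Σ ℕ λ A → Σ ℕ λ a → LEdge g k u A a v

Path : (g k : ℕ) → Node k → Node k → Set
Path g k = Star (Edge g k)

InH : (g k : ℕ) → Node k → Set
InH g k u = Path g k start u

EvenPivot : (g k : ℕ) → Node k → Set
EvenPivot g k start = Data.Empty.⊥
  where import Data.Empty
EvenPivot g k (node R r) = R ≡ r

OddPivot : (g k : ℕ) → Node k → Set
OddPivot g k start = Data.Empty.⊥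
  where import Data.Empty
OddPivot g k (node r s) = Edge g k (node r s) (node s r)

Pivot : (g k : ℕ) → Node k → Set
Pivot g k u = EvenPivot g k u ⊎ OddPivot g k u

InY : (g k : ℕ) → Node k → Set
InY g k u = InH g k u × ∃ λ v → Path g k u v × Pivot g k v

record YIso (g k g' k' : ℕ) : Set where
  field
    to      : Node k → Node k'
    from    : Node k' → Node k
    to-in   : ∀ u → InY g k u → InY g' k' (to u)
    from-in : ∀ v → InY g' k' v → InY g k (from v)
    from-to : ∀ u → InY g k u → from (to u) ≡ u
    to-from : ∀ v → InY g' k' v → to (from v) ≡ v
    edge    : ∀ u v → InY g k u → InY g k v →
              Edge g k u v ⇔ Edge g' k' (to u) (to v)
    even    : ∀ u → InY g k u → EvenPivot g k u ⇔ EvenPivot g' k' (to u)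
    odd     : ∀ u → InY g k u → OddPivot g k u ⇔ OddPivot g' k' (to u)

module Submission where

-- Everything rests on the classification
-- "Y(g,k) is a 1089 graph  ⇔  (k+1) ∣ g", proved in the module YoungGraphs:
--  * If g = m(k+1), k = d+1, the label equations of an edge [P,p] → [R,r] force R = p and
--    d·A + p = m·(r + k·P) (edge-arithmetic).  Modulo d this lets one follow the digits: a
--    node is either aligned (d divides both digits) or doomed, a condition inherited by all
--    successors and excluding pivots.  So Y(g,k) lives on the start and the four digit
--    pairs over {0, d}, and its edges and pivots are those of a fixed model graph on these
--    five corners (module Standard).  Any two such graphs are therefore isomorphic.
--  * Conversely, an isomorphism onto such a graph fixes the start and transports the launch
--    [[0,0]] → [0,d] → [d,d] ⟲, whose middle node is no odd pivot; in Y(g,k) this configuration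
--    forces (k+1) ∣ g (module Launch).
-- The corollary then follows: with f as in the statement, f(k₀) ∣ g₀, hence f(k₀) ∣ g₀(k₀+1),
-- so Y(g₀,k₀) ≅ Y(g₀(k₀+1),k₀), which is a 1089 graph; conversely f(k) = k+1 works.

module YoungGraphs where

  open import Defs
  open import Data.Nat
  open import Data.Nat.Properties
  open import Data.Nat.Divisibility
  open import Data.Nat.DivMod using (_%_; m<n⇒m%n≡m; [m+kn]%n≡m%n)
  open import Data.Nat.Tactic.RingSolver using (solve-∀)
  open import Data.Fin using (Fin; toℕ; fromℕ; zero; suc)
  open import Data.Fin.Properties using (toℕ<n; toℕ-fromℕ; toℕ-injective)
  open import Data.Bool using (Bool; true; false)
  open import Data.Product using (Σ; ∃; _×_; _,_; proj₁; proj₂)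
  open import Data.Sum using (_⊎_; inj₁; inj₂; fromInj₂)
  open import Data.Empty using (⊥; ⊥-elim)
  open import Relation.Nullary using (¬_; yes; no)
  open import Relation.Binary.PropositionalEquality
  open import Relation.Binary.Construct.Closure.ReflexiveTransitive using (ε; _◅_)
  open import Function.Bundles using (_⇔_; mk⇔; Equivalence)
  open import Function.Properties.Equivalence using () renaming (refl to ⇔-refl; trans to ⇔-trans; sym to ⇔-sym)
  open ≡-Reasoning

  -- Two residues x, y < k+1 with (k+1) ∣ x + k·y coincide, since k ≡ -1 mod k+1.
  residues-cancel : ∀ k x y → x < suc k → y < suc k → suc k ∣ x + k * y → x ≡ y
  residues-cancel k x y x<n y<n (divides q eq) = begin
    x                       ≡⟨ sym (m<n⇒m%n≡m x<n) ⟩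
    x % suc k               ≡⟨ sym ([m+kn]%n≡m%n x y (suc k)) ⟩
    (x + y * suc k) % suc k ≡⟨ cong (_% suc k) shift ⟩
    (y + q * suc k) % suc k ≡⟨ [m+kn]%n≡m%n y q (suc k) ⟩
    y % suc k               ≡⟨ m<n⇒m%n≡m y<n ⟩
    y                       ∎
    where
    regroup : ∀ k x y → x + y * suc k ≡ y + (x + k * y)
    regroup = solve-∀
    shift : x + y * suc k ≡ y + q * suc k
    shift = trans (regroup k x y) (cong (y +_) eq)

  divisor-extremes : ∀ {d x} → x ≤ d → d ∣ x → x ≡ 0 ⊎ x ≡ d
  divisor-extremes {zero}  x≤0 _                    = inj₁ (n≤0⇒n≡0 x≤0)
  divisor-extremes         _   (divides zero eq)    = inj₁ eq
  divisor-extremes {suc d} _   (divides 1 eq)       = inj₂ (trans eq (+-identityʳ (suc d)))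
  divisor-extremes {suc d} x≤d (divides (2+ q) eq) = ⊥-elim (m+1+n≰m (suc d) (subst (_≤ suc d) eq x≤d))

  edge-arithmetic : ∀ d m {P p R r A a} → p < suc d → R < suc d →
    suc d * a + p ≡ A + r * (m * suc (suc d)) →
    suc d * A + R ≡ a + P * (m * suc (suc d)) →
    R ≡ p × d * A + p ≡ m * (r + suc d * P)
  edge-arithmetic d m {P} {p} {R} {r} {A} {a} p<k R<k e₁ e₂ = R≡p , label
    where
    k : ℕ
    k = suc d
    expandˡ : ∀ d a p A R → (suc d * a + p) + suc d * (suc d * A + R)
            ≡ (suc d * a + A) + ((p + suc d * R) + suc (suc d) * (d * A))
    expandˡ = solve-∀
    expandʳ : ∀ d m a A r P → (A + r * (m * suc (suc d))) + suc d * (a + P * (m * suc (suc d)))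
            ≡ (suc d * a + A) + suc (suc d) * ((r + suc d * P) * m)
    expandʳ = solve-∀
    -- k·(second equation) + (first equation), with k·a + A cancelled
    combined : (p + k * R) + suc k * (d * A) ≡ suc k * ((r + k * P) * m)
    combined = +-cancelˡ-≡ (k * a + A) _ _ (begin
      (k * a + A) + ((p + k * R) + suc k * (d * A)) ≡⟨ sym (expandˡ d a p A R) ⟩
      (k * a + p) + k * (k * A + R)                 ≡⟨ cong₂ (λ x y → x + k * y) e₁ e₂ ⟩
      (A + r * (m * suc k)) + k * (a + P * (m * suc k)) ≡⟨ expandʳ d m a A r P ⟩
      (k * a + A) + suc k * ((r + k * P) * m)       ∎)
    k+1∣p+kR : suc k ∣ p + k * R
    k+1∣p+kR = ∣m+n∣m⇒∣n
      (subst (suc k ∣_) (trans (sym combined) (+-comm (p + k * R) _)) (m∣m*n ((r + k * P) * m)))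
      (m∣m*n (d * A))
    R≡p : R ≡ p
    R≡p = sym (residues-cancel k p R (m≤n⇒m≤1+n p<k) (m≤n⇒m≤1+n R<k) k+1∣p+kR)
    regroup : ∀ d p A → (p + suc d * p) + suc (suc d) * (d * A) ≡ suc (suc d) * (d * A + p)
    regroup = solve-∀
    label : d * A + p ≡ m * (r + k * P)
    label = trans (*-cancelˡ-≡ _ _ (suc k) (begin
      suc k * (d * A + p)                 ≡⟨ sym (regroup d p A) ⟩
      (p + k * p) + suc k * (d * A)       ≡⟨ cong (λ x → (p + k * x) + suc k * (d * A)) (sym R≡p) ⟩
      (p + k * R) + suc k * (d * A)       ≡⟨ combined ⟩
      suc k * ((r + k * P) * m)           ∎)) (*-comm _ m)

  -- The arithmetic trace of an edge [a,b] → [b,c] (see edge-arithmetic).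
  Transition : ℕ → ℕ → ℕ → ℕ → ℕ → Set
  Transition d m a b c = Σ ℕ λ A → d * A + b ≡ m * (c + suc d * a)

  -- Modulo d a transition reads b ≡ m·(a + c); multiplied by any M it gives:
  -- if d ∣ m·M·a, then d ∣ m·M·c exactly when d ∣ M·b.
  transition-mod : ∀ d m {a b c} → Transition d m a b c → ∀ M → d ∣ m * M * a →
    d ∣ m * M * c ⇔ d ∣ M * b
  transition-mod d m {a} {b} {c} (A , eq) M d∣mMa = mk⇔ forward backward
    where
    N : ℕ
    N = m * M
    scaled : N * c + (N * a + d * (N * a)) ≡ d * (M * A) + M * b
    scaled = begin
      N * c + (N * a + d * (N * a)) ≡⟨ regroupˡ M m d c a ⟩
      M * (m * (c + suc d * a))     ≡⟨ cong (M *_) (sym eq) ⟩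
      M * (d * A + b)               ≡⟨ regroupʳ M d A b ⟩
      d * (M * A) + M * b           ∎
      where
      regroupʳ : ∀ M d A b → M * (d * A + b) ≡ d * (M * A) + M * b
      regroupʳ = solve-∀
      regroupˡ : ∀ M m d c a → (m * M) * c + ((m * M) * a + d * ((m * M) * a)) ≡ M * (m * (c + suc d * a))
      regroupˡ = solve-∀
    d∣rest : d ∣ N * a + d * (N * a)
    d∣rest = ∣m∣n⇒∣m+n d∣mMa (m∣m*n (N * a))
    forward : d ∣ N * c → d ∣ M * b
    forward d∣Nc = ∣m+n∣m⇒∣n (subst (d ∣_) scaled (∣m∣n⇒∣m+n d∣Nc d∣rest)) (m∣m*n (M * A))
    backward : d ∣ M * b → d ∣ N * c
    backward d∣Mb = ∣m+n∣m⇒∣n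
      (subst (d ∣_) (trans (sym scaled) (+-comm (N * c) _)) (∣m∣n⇒∣m+n (m∣m*n (M * A)) d∣Mb))
      d∣rest

  Aligned : ℕ → ℕ → ℕ → Set
  Aligned d a b = d ∣ a × d ∣ b

  -- A digit pair [a,b] is doomed at depth j when m^j·a vanishes mod d but m^j·b does
  -- not, while m^(j+1)·b does; this obstruction survives every transition.
  Doomed : ℕ → ℕ → ℕ → ℕ → ℕ → Set
  Doomed d m j a b = d ∣ m ^ j * a × ¬ d ∣ m ^ j * b × d ∣ m ^ suc j * b

  scale-∣ : ∀ {d} m M a → d ∣ M * a → d ∣ m * M * a
  scale-∣ {d} m M a d∣Ma = subst (d ∣_) (sym (*-assoc m M a)) (∣n⇒∣m*n m d∣Ma)

  aligned-step : ∀ d m {a b c} → Aligned d a b → Transition d m a b c →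
    Aligned d b c ⊎ Doomed d m 0 b c
  aligned-step d m {a} {b} {c} (d∣a , d∣b) t with d ∣? c
  ... | yes d∣c = inj₁ (d∣b , d∣c)
  ... | no d∤c = inj₂ (d∣1b , (λ d∣1c → d∤c (subst (d ∣_) (*-identityˡ c) d∣1c)) , d∣m1c)
    where
    d∣1b : d ∣ 1 * b
    d∣1b = subst (d ∣_) (sym (*-identityˡ b)) d∣b
    d∣m1c : d ∣ m * 1 * c
    d∣m1c = Equivalence.from (transition-mod d m t 1 (∣n⇒∣m*n (m * 1) d∣a)) d∣1b

  doomed-step : ∀ d m j {a b c} → Doomed d m j a b → Transition d m a b c → Doomed d m (suc j) b c
  doomed-step d m j {a} {b} {c} (d∣Ma , d∤Mb , d∣mMb) t = d∣mMb , d∤mMc , d∣mmMc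
    where
    M : ℕ
    M = m ^ j
    d∤mMc : ¬ d ∣ m * M * c
    d∤mMc d∣mMc = d∤Mb (Equivalence.to (transition-mod d m t M (scale-∣ m M a d∣Ma)) d∣mMc)
    d∣mmMc : d ∣ m * (m * M) * c
    d∣mmMc = Equivalence.from
      (transition-mod d m t (m * M) (scale-∣ m (m * M) a (scale-∣ m M a d∣Ma))) d∣mMb

  doomed-not-even : ∀ d m j {a} → ¬ Doomed d m j a a
  doomed-not-even d m j (d∣Ma , d∤Ma , _) = d∤Ma d∣Ma

  doomed-not-odd : ∀ d m j {a b} → Transition d m a b a → ¬ Doomed d m j a b
  doomed-not-odd d m j {a} t doomed@(d∣Ma , _) with doomed-step d m j doomed t
  ... | _ , d∤mMa , _ = d∤mMa (scale-∣ m (m ^ j) a d∣Ma)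

  first second : ∀ {k} → Node k → ℕ
  first start      = 0
  first (node P p) = toℕ P
  second start      = 0
  second (node P p) = toℕ p

  along : ∀ {g k} (Q : Node k → Set) → (∀ {u v} → Edge g k u v → Q u → Q v) →
    ∀ {u v} → Path g k u v → Q u → Q v
  along Q step ε        q = q
  along Q step (e ◅ es) q = along Q step es (step e q)

  module Multiple (d m : ℕ) where
    k g : ℕ
    k = suc d
    g = m * suc k

    label-arithmetic : ∀ {u R r A a} → LEdge g k u A a (node R r) →
      toℕ R ≡ second u × d * A + second u ≡ m * (toℕ r + k * first u)
    label-arithmetic {r = r} (fromStart _ _ _ _ e₁ e₂) =
      edge-arithmetic d m {P = 0} {r = toℕ r} (s≤s z≤n) (toℕ<n _) e₁ e₂
    label-arithmetic {node P p} {r = r} (fromNode _ _ e₁ e₂) =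
      edge-arithmetic d m {P = toℕ P} {r = toℕ r} (toℕ<n p) (toℕ<n _) e₁ e₂

    edge-transition : ∀ {u R r} → Edge g k u (node R r) →
      toℕ R ≡ second u × Transition d m (first u) (second u) (toℕ r)
    edge-transition (A , _ , ℓ) with label-arithmetic ℓ
    ... | R≡p , eq = R≡p , (A , eq)

    DoomedNode Fate : Node k → Set
    DoomedNode u = ∃ λ j → Doomed d m j (first u) (second u)
    Fate u = Aligned d (first u) (second u) ⊎ DoomedNode u

    doomed-edge : ∀ {u v} → Edge g k u v → DoomedNode u → DoomedNode v
    doomed-edge {v = start} (_ , _ , ())
    doomed-edge {v = node R r} e (j , doomed) with edge-transition e
    ... | R≡p , t = suc j , subst (λ x → Doomed d m (suc j) x (toℕ r)) (sym R≡p) (doomed-step d m j doomed t)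

    fate-edge : ∀ {u v} → Edge g k u v → Fate u → Fate v
    fate-edge {v = start} (_ , _ , ())
    fate-edge {v = node R r} e (inj₁ aligned) with edge-transition e
    ... | R≡p , t with aligned-step d m aligned t
    ...   | inj₁ aligned′ = inj₁ (subst (λ x → Aligned d x (toℕ r)) (sym R≡p) aligned′)
    ...   | inj₂ doomed   = inj₂ (0 , subst (λ x → Doomed d m 0 x (toℕ r)) (sym R≡p) doomed)
    fate-edge e (inj₂ doomed) = inj₂ (doomed-edge e doomed)

    doomed-not-pivot : ∀ {u} → DoomedNode u → ¬ Pivot g k u
    doomed-not-pivot {node P p} (j , doomed) (inj₁ refl) = doomed-not-even d m j doomed
    doomed-not-pivot {node P p} (j , doomed) (inj₂ e)    = doomed-not-odd d m j (proj₂ (edge-transition e)) doomed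

    -- Every node of Y(g,k) is aligned: the start is, and a doomed node can reach no pivot.
    inY-aligned : ∀ {u} → InY g k u → Aligned d (first u) (second u)
    inY-aligned (π , v , ρ , pivot) with along Fate fate-edge π (inj₁ (d ∣0 , d ∣0))
    ... | inj₁ aligned = aligned
    ... | inj₂ doomed  = ⊥-elim (doomed-not-pivot (along DoomedNode doomed-edge ρ doomed) pivot)

  reindex : ∀ {A : Set} (R : A → A → Set) {u u′ v v′} → u ≡ u′ → v ≡ v′ → R u v ⇔ R u′ v′
  reindex R refl refl = ⇔-refl

  reindex₁ : ∀ {A : Set} (Q : A → Set) {u u′} → u ≡ u′ → Q u ⇔ Q u′
  reindex₁ Q refl = ⇔-refl

  -- The model 1089 graph: the start and the four digit pairs ⟨x,y⟩, a Boolean standing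
  -- for the digit 0 (false) or d (true).
  data Corner : Set where
    origin : Corner
    ⟨_,_⟩  : Bool → Bool → Corner

  -- The walks 0,d,0 and d,0,d of digits, the only ones that carry no edge.
  data Zigzag : Bool → Bool → Bool → Set where
    up-down : Zigzag false true false
    down-up : Zigzag true false true

  data Step : Corner → Corner → Set where
    launch : Step origin ⟨ false , true ⟩
    turn   : ∀ {x y z} → ¬ Zigzag x y z → Step ⟨ x , y ⟩ ⟨ y , z ⟩

  CornerEven CornerOdd : Corner → Set
  CornerEven origin    = ⊥
  CornerEven ⟨ x , y ⟩ = x ≡ y
  CornerOdd origin    = ⊥
  CornerOdd ⟨ x , y ⟩ = Step ⟨ x , y ⟩ ⟨ y , x ⟩

  below : ∀ {A g} n → A + suc n ≡ g → A < g
  below {A} n eq = subst (A <_) eq (m<m+n A (s≤s z≤n))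

  module Standard (e m′ : ℕ) where
    d m : ℕ
    d = suc e
    m = suc m′
    open Multiple d m public using (k; g; label-arithmetic; edge-transition; inY-aligned)

    value : Bool → ℕ
    value false = 0
    value true  = d

    level : Bool → Fin k
    level false = zero
    level true  = fromℕ d

    toℕ-level : ∀ b → toℕ (level b) ≡ value b
    toℕ-level false = refl
    toℕ-level true  = toℕ-fromℕ d

    level-injective : ∀ {x y} → toℕ (level x) ≡ toℕ (level y) → x ≡ y
    level-injective {false} {false} _ = refl
    level-injective {true}  {true}  _ = refl
    level-injective {false} {true}  ()
    level-injective {true}  {false} ()

    embed : Corner → Node k
    embed origin    = start
    embed ⟨ x , y ⟩ = node (level x) (level y)

    leap : ∀ e m′ → suc (suc e) * (suc (suc e) * suc m′) + 0 ≡ suc m′ + suc e * (suc m′ * suc (suc (suc e)))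
    leap = solve-∀
    climb : ∀ e m′ → suc (suc e) * (suc (suc e) * m′ + suc e) + suc e ≡ m′ + suc e * (suc m′ * suc (suc (suc e)))
    climb = solve-∀
    crest : ∀ e m′ → suc (suc e) * (suc (suc e) + m′ * suc (suc (suc e))) + suc e
                   ≡ (suc (suc e) + m′ * suc (suc (suc e))) + suc e * (suc m′ * suc (suc (suc e)))
    crest = solve-∀
    m<g : m < g
    m<g = below (m′ * k + d) (gap e m′)
      where gap : ∀ e m′ → suc m′ + suc (m′ * suc (suc e) + suc e) ≡ suc m′ * suc (suc (suc e))
            gap = solve-∀
    km<g : k * m < g
    km<g = below m′ (gap e m′)
      where gap : ∀ e m′ → suc (suc e) * suc m′ + suc m′ ≡ suc m′ * suc (suc (suc e))
            gap = solve-∀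
    m′<g : m′ < g
    m′<g = below (m * k) (gap e m′)
      where gap : ∀ e m′ → m′ + suc (suc m′ * suc (suc e)) ≡ suc m′ * suc (suc (suc e))
            gap = solve-∀
    km′+d<g : k * m′ + d < g
    km′+d<g = below (suc m′) (gap e m′)
      where gap : ∀ e m′ → (suc (suc e) * m′ + suc e) + suc (suc m′) ≡ suc m′ * suc (suc (suc e))
            gap = solve-∀
    top-label : ℕ
    top-label = k + m′ * suc k
    top-label<g : top-label < g
    top-label<g = below 0 (gap e m′)
      where gap : ∀ e m′ → (suc (suc e) + m′ * suc (suc (suc e))) + 1 ≡ suc m′ * suc (suc (suc e))
            gap = solve-∀

    turn-edge : ∀ x y z (A a : ℕ) → A < g → a < g →
      k * a + value y ≡ A + value z * g → k * A + value y ≡ a + value x * g →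
      Edge g k (embed ⟨ x , y ⟩) (embed ⟨ y , z ⟩)
    turn-edge x y z A a A<g a<g e₁ e₂
      rewrite sym (toℕ-level x) | sym (toℕ-level y) | sym (toℕ-level z) = A , a , fromNode A<g a<g e₁ e₂

    step-edge : ∀ {c c′} → Step c c′ → Edge g k (embed c) (embed c′)
    step-edge launch = m , k * m , fromStart m<g km<g (λ ()) (λ ()) e₁ refl
      where e₁ : k * (k * m) + 0 ≡ m + toℕ (level true) * g
            e₁ = trans (leap e m′) (cong (λ x → m + x * g) (sym (toℕ-level true)))
    step-edge (turn {false} {false} {false} _) =
      turn-edge false false false 0 0 (s≤s z≤n) (s≤s z≤n) silent silent
      where silent : k * 0 + 0 ≡ 0
            silent = trans (+-identityʳ (k * 0)) (*-zeroʳ k)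
    step-edge (turn {false} {false} {true} _) =
      turn-edge false false true m (k * m) m<g km<g (leap e m′) refl
    step-edge (turn {false} {true} {true} _) =
      turn-edge false true true m′ (k * m′ + d) m′<g km′+d<g (climb e m′) (sym (+-identityʳ _))
    step-edge (turn {true} {true} {true} _) =
      turn-edge true true true top-label top-label top-label<g top-label<g (crest e m′) (crest e m′)
    step-edge (turn {true} {true} {false} _) =
      turn-edge true true false (k * m′ + d) m′ km′+d<g m′<g (sym (+-identityʳ _)) (climb e m′)
    step-edge (turn {true} {false} {false} _) =
      turn-edge true false false (k * m) m km<g m<g refl (leap e m′)
    step-edge (turn {false} {true} {false} no-zigzag) = ⊥-elim (no-zigzag up-down)
    step-edge (turn {true} {false} {true} no-zigzag)  = ⊥-elim (no-zigzag down-up)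

    vanish : ∀ a b → a * (0 + b * 0) ≡ 0
    vanish = solve-∀

    launch-target : ∀ {y z} → Edge g k start (embed ⟨ y , z ⟩) → y ≡ false × z ≡ true
    launch-target {y} {z} (A , a , ℓ@(fromStart _ _ A≢0 _ _ _)) =
      level-injective (proj₁ arithmetic) , second-digit z (proj₂ arithmetic)
      where
      arithmetic : toℕ (level y) ≡ 0 × d * A + 0 ≡ m * (toℕ (level z) + k * 0)
      arithmetic = label-arithmetic ℓ
      silent : ∀ A → d * A + 0 ≡ 0 → A ≡ 0
      silent zero    _  = refl
      silent (suc A) ()
      second-digit : ∀ z → d * A + 0 ≡ m * (toℕ (level z) + k * 0) → z ≡ true
      second-digit true  _  = refl
      second-digit false eq = ⊥-elim (A≢0 (silent A (trans eq (vanish m k))))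

    turn-shape : ∀ {x y y′ z} → Edge g k (embed ⟨ x , y ⟩) (embed ⟨ y′ , z ⟩) → y′ ≡ y
    turn-shape e = level-injective (proj₁ (edge-transition e))

    -- Zigzags carry no edge: 0,d,0 would need d·A + d = 0, and d,0,d the label A = g.
    no-zigzag : ∀ {x y z} → Zigzag x y z → ¬ Edge g k (embed ⟨ x , y ⟩) (embed ⟨ y , z ⟩)
    no-zigzag up-down (A , a , ℓ) = positive (begin
      d * A + d                      ≡⟨ cong (d * A +_) (sym (toℕ-level true)) ⟩
      d * A + toℕ (level true)       ≡⟨ proj₂ (label-arithmetic ℓ) ⟩
      m * (0 + k * 0)                ≡⟨ vanish m k ⟩
      0                              ∎)
      where
      positive : d * A + d ≢ 0
      positive eq with () ← trans (sym (+-suc (d * A) e)) eq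
    no-zigzag down-up (A , a , ℓ@(fromNode A<g _ _ _)) = <-irrefl (*-cancelˡ-≡ A g d (begin
      d * A                                         ≡⟨ sym (+-identityʳ (d * A)) ⟩
      d * A + 0                                     ≡⟨ proj₂ (label-arithmetic ℓ) ⟩
      m * (toℕ (level true) + k * toℕ (level true)) ≡⟨ cong (λ x → m * (x + k * x)) (toℕ-level true) ⟩
      m * (d + k * d)                               ≡⟨ full-turn e m′ ⟩
      d * g                                         ∎)) A<g
      where
      full-turn : ∀ e m′ → suc m′ * (suc e + suc (suc e) * suc e) ≡ suc e * (suc m′ * suc (suc (suc e)))
      full-turn = solve-∀

    edge-step : ∀ {c c′} → Edge g k (embed c) (embed c′) → Step c c′
    edge-step {c′ = origin} (_ , _ , ())
    edge-step {origin} {⟨ y , z ⟩} e =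
      subst₂ (λ y z → Step origin ⟨ y , z ⟩) (sym y≡false) (sym z≡true) launch
      where
      y≡false : y ≡ false
      y≡false = proj₁ (launch-target {y} {z} e)
      z≡true : z ≡ true
      z≡true = proj₂ (launch-target {y} {z} e)
    edge-step {⟨ x , y ⟩} {⟨ y′ , z ⟩} e =
      subst (λ w → Step ⟨ x , y ⟩ ⟨ w , z ⟩) (sym y′≡y) (turn (λ zigzag → no-zigzag zigzag e′))
      where
      y′≡y : y′ ≡ y
      y′≡y = turn-shape {x} {y} {y′} {z} e
      e′ : Edge g k (embed ⟨ x , y ⟩) (embed ⟨ y , z ⟩)
      e′ = subst (λ w → Edge g k (embed ⟨ x , y ⟩) (embed ⟨ w , z ⟩)) y′≡y e

    edge⇔step : ∀ c c′ → Edge g k (embed c) (embed c′) ⇔ Step c c′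
    edge⇔step c c′ = mk⇔ edge-step step-edge

    even⇔ : ∀ c → EvenPivot g k (embed c) ⇔ CornerEven c
    even⇔ origin    = mk⇔ (λ ()) (λ ())
    even⇔ ⟨ x , y ⟩ = mk⇔ (λ eq → level-injective (cong toℕ eq)) (cong level)

    odd⇔ : ∀ c → OddPivot g k (embed c) ⇔ CornerOdd c
    odd⇔ origin    = mk⇔ (λ ()) (λ ())
    odd⇔ ⟨ x , y ⟩ = edge⇔step ⟨ x , y ⟩ ⟨ y , x ⟩

    aligned-digit : (P : Fin k) → d ∣ toℕ P → ∃ λ b → level b ≡ P
    aligned-digit P d∣P with divisor-extremes (s≤s⁻¹ (toℕ<n P)) d∣P
    ... | inj₁ P≡0 = false , toℕ-injective (sym P≡0)
    ... | inj₂ P≡d = true  , toℕ-injective (trans (toℕ-fromℕ d) (sym P≡d))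

    inY-corner : ∀ {u} → InY g k u → ∃ λ c → embed c ≡ u
    inY-corner {start} _ = origin , refl
    inY-corner {node P p} iy with inY-aligned iy
    ... | d∣P , d∣p with aligned-digit P d∣P | aligned-digit p d∣p
    ...   | x , refl | y , refl = ⟨ x , y ⟩ , refl

    -- Launch, climb, descent and landing: a walk through all corners to both even pivots.
    launched : Edge g k (embed origin) (embed ⟨ false , true ⟩)
    launched = step-edge launch
    climbed : Edge g k (embed ⟨ false , true ⟩) (embed ⟨ true , true ⟩)
    climbed = step-edge (turn {false} {true} {true} (λ ()))
    descended : Edge g k (embed ⟨ true , true ⟩) (embed ⟨ true , false ⟩)
    descended = step-edge (turn {true} {true} {false} (λ ()))
    landed : Edge g k (embed ⟨ true , false ⟩) (embed ⟨ false , false ⟩)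
    landed = step-edge (turn {true} {false} {false} (λ ()))

    corner-inY : ∀ c → InY g k (embed c)
    corner-inY origin =
      ε , embed ⟨ true , true ⟩ , launched ◅ climbed ◅ ε , inj₁ refl
    corner-inY ⟨ false , false ⟩ =
      launched ◅ climbed ◅ descended ◅ landed ◅ ε , embed ⟨ false , false ⟩ , ε , inj₁ refl
    corner-inY ⟨ false , true ⟩ =
      launched ◅ ε , embed ⟨ true , true ⟩ , climbed ◅ ε , inj₁ refl
    corner-inY ⟨ true , false ⟩ =
      launched ◅ climbed ◅ descended ◅ ε , embed ⟨ false , false ⟩ , landed ◅ ε , inj₁ refl
    corner-inY ⟨ true , true ⟩ =
      launched ◅ climbed ◅ ε , embed ⟨ true , true ⟩ , ε , inj₁ refl

    isTop : Fin k → Bool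
    isTop zero    = false
    isTop (suc _) = true

    decode : Node k → Corner
    decode start      = origin
    decode (node P p) = ⟨ isTop P , isTop p ⟩

    decode-embed : ∀ c → decode (embed c) ≡ c
    decode-embed origin    = refl
    decode-embed ⟨ x , y ⟩ = cong₂ ⟨_,_⟩ (isTop-level x) (isTop-level y)
      where isTop-level : ∀ b → isTop (level b) ≡ b
            isTop-level false = refl
            isTop-level true  = refl

    embed-decode : ∀ {u} → InY g k u → embed (decode u) ≡ u
    embed-decode iy with inY-corner iy
    ... | c , refl = cong embed (decode-embed c)

  -- Any two Young graphs with (k+1) ∣ g are isomorphic, both being copies of the model.
  standard-iso : ∀ e₁ m₁ e₂ m₂ →
    YIso (Standard.g e₁ m₁) (Standard.k e₁ m₁) (Standard.g e₂ m₂) (Standard.k e₂ m₂)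
  standard-iso e₁ m₁ e₂ m₂ = record
    { to      = λ u → S₂.embed (S₁.decode u)
    ; from    = λ v → S₁.embed (S₂.decode v)
    ; to-in   = λ u _ → S₂.corner-inY (S₁.decode u)
    ; from-in = λ v _ → S₁.corner-inY (S₂.decode v)
    ; from-to = λ u iu → trans (cong S₁.embed (S₂.decode-embed (S₁.decode u))) (S₁.embed-decode iu)
    ; to-from = λ v iv → trans (cong S₂.embed (S₁.decode-embed (S₂.decode v))) (S₂.embed-decode iv)
    ; edge    = λ u v iu iv → ⇔-trans
        (reindex (Edge S₁.g S₁.k) (sym (S₁.embed-decode iu)) (sym (S₁.embed-decode iv)))
        (⇔-trans (S₁.edge⇔step _ _) (⇔-sym (S₂.edge⇔step _ _)))
    ; even    = λ u iu → ⇔-trans (reindex₁ (EvenPivot S₁.g S₁.k) (sym (S₁.embed-decode iu)))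
        (⇔-trans (S₁.even⇔ _) (⇔-sym (S₂.even⇔ _)))
    ; odd     = λ u iu → ⇔-trans (reindex₁ (OddPivot S₁.g S₁.k) (sym (S₁.embed-decode iu)))
        (⇔-trans (S₁.odd⇔ _) (⇔-sym (S₂.odd⇔ _)))
    }
    where
    module S₁ = Standard e₁ m₁
    module S₂ = Standard e₂ m₂

  module Launch (e g : ℕ) where
    d k : ℕ
    d = suc e
    k = suc d

    -- A loop at [c,c] has equal labels D, and then d·D + c = c·g.
    loop-equation : ∀ {c D D′} → k * D′ + c ≡ D + c * g → k * D + c ≡ D′ + c * g → d * D + c ≡ c * g
    loop-equation {c} {D} {D′} l₁ l₂ = +-cancelˡ-≡ D _ _ (trans (sym (unfold D)) (subst (λ x → k * D + c ≡ x + c * g) D′≡D l₂))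
      where
      unfold : ∀ x → k * x + c ≡ x + (d * x + c)
      unfold x = lemma e x c
        where lemma : ∀ e x c → suc (suc e) * x + c ≡ x + (suc e * x + c)
              lemma = solve-∀
      swap : ∀ x y z → x + (y + z) ≡ y + (x + z)
      swap = solve-∀
      D′≡D : D′ ≡ D
      D′≡D = *-cancelˡ-≡ D′ D (suc k) (+-cancelʳ-≡ c _ _ (begin
        suc k * D′ + c     ≡⟨ +-assoc D′ (k * D′) c ⟩
        D′ + (k * D′ + c)  ≡⟨ cong (D′ +_) l₁ ⟩
        D′ + (D + c * g)   ≡⟨ swap D′ D (c * g) ⟩
        D + (D′ + c * g)   ≡⟨ cong (D +_) (sym l₂) ⟩
        D + (k * D + c)    ≡⟨ sym (+-assoc D (k * D) c) ⟩
        suc k * D + c      ∎))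

    two-step-equation : ∀ {r c R b B D} → k * b + r ≡ B + c * g → k * B + c ≡ b + R * g →
      d * D + c ≡ c * g → d * (b + B) + r ≡ d * D + R * g
    two-step-equation {r} {c} {R} {b} {B} {D} f₁ f₂ loop = +-cancelʳ-≡ (b + B + c) _ _ (begin
      (d * (b + B) + r) + (b + B + c)  ≡⟨ spread e b B r c ⟩
      (k * b + r) + (k * B + c)        ≡⟨ cong₂ _+_ f₁ f₂ ⟩
      (B + c * g) + (b + R * g)        ≡⟨ cong (λ x → (B + x) + (b + R * g)) (sym loop) ⟩
      (B + (d * D + c)) + (b + R * g)  ≡⟨ gather e b B c D R g ⟩
      (d * D + R * g) + (b + B + c)    ∎)
      where
      spread : ∀ e b B r c → (suc e * (b + B) + r) + (b + B + c) ≡ (suc (suc e) * b + r) + (suc (suc e) * B + c)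
      spread = solve-∀
      gather : ∀ e b B c D R G → (B + (suc e * D + c)) + (b + R * G) ≡ (suc e * D + R * G) + (b + B + c)
      gather = solve-∀

    -- A launch with labels A, a to [R,0] would force A = 0: k·A ≤ a ≤ k·a = A.
    silent-launch : ∀ {A a R} → k * a + 0 ≡ A + 0 → k * A + R ≡ a + 0 → A ≡ 0
    silent-launch {zero}  _  _  = refl
    silent-launch {suc A} {a} {R} s₁ s₂ = ⊥-elim (m+1+n≰m (suc A) kA≤A)
      where
      kA≤a : k * suc A ≤ a
      kA≤a = ≤-trans (m≤m+n (k * suc A) R) (≤-reflexive (trans s₂ (+-identityʳ a)))
      kA≤A : k * suc A ≤ suc A
      kA≤A = ≤-trans kA≤a (≤-trans (m≤n*m a k) (≤-reflexive (+-cancelʳ-≡ 0 _ _ s₁)))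

    -- A launch to [0,d] has labels A, k·A with (k+1)·A = g.
    launch-divides : ∀ {A a} → k * a + 0 ≡ A + d * g → k * A + 0 ≡ a + 0 → suc k ∣ g
    launch-divides {A} {a} s₁ s₂ = divides A (sym (*-cancelˡ-≡ (A * suc k) g d (+-cancelˡ-≡ A _ _ (begin
      A + d * (A * suc k)  ≡⟨ sym (expand e A) ⟩
      k * (k * A) + 0      ≡⟨ cong (λ x → k * x + 0) (+-cancelʳ-≡ 0 _ _ s₂) ⟩
      k * a + 0            ≡⟨ s₁ ⟩
      A + d * g            ∎))))
      where expand : ∀ e A → suc (suc e) * (suc (suc e) * A) + 0 ≡ A + suc e * (A * suc (suc (suc e)))
            expand = solve-∀

    launch-moves : ∀ {A a R} r → A ≢ 0 → k * a + 0 ≡ A + r * g → k * A + R ≡ a + 0 * g → 1 ≤ r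
    launch-moves zero    A≢0 s₁ s₂ = ⊥-elim (A≢0 (silent-launch s₁ s₂))
    launch-moves (suc _) _   _  _  = s≤s z≤n

    excess : ∀ {x D r R} → r < g → d * x + r ≡ d * D + suc R * g → ∃ λ X → d * X + r ≡ suc R * g
    excess {x} {D} {r} {R} r<g eq with ≤-total x D
    ... | inj₁ x≤D = ⊥-elim (<-irrefl eq (≤-<-trans (+-monoˡ-≤ r (*-monoʳ-≤ d x≤D))
                                           (+-monoʳ-< (d * D) (<-≤-trans r<g (m≤m+n g (R * g))))))
    ... | inj₂ D≤x with m≤n⇒∃[o]m+o≡n D≤x
    ...   | X , refl = X , +-cancelˡ-≡ (d * D) _ _ (trans (sym (regroup d D X r)) eq)
      where regroup : ∀ d D X r → d * (D + X) + r ≡ d * D + (d * X + r)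
            regroup = solve-∀

    reverse-edge : ∀ {R r : Fin k} X → 1 ≤ toℕ r → d * X + toℕ r ≡ toℕ R * g → OddPivot g k (node R r)
    reverse-edge {R} {r} X 1≤r eq = X , X , fromNode X<g X<g turned turned
      where
      split : ∀ e X r → suc (suc e) * X + r ≡ X + (suc e * X + r)
      split = solve-∀
      turned : k * X + toℕ r ≡ X + toℕ R * g
      turned = trans (split e X (toℕ r)) (cong (X +_) eq)
      X<g : X < g
      X<g = ≰⇒> λ g≤X → <-irrefl refl (≤-<-trans (*-monoˡ-≤ g (s≤s⁻¹ (toℕ<n R)))
              (≤-<-trans (*-monoʳ-≤ d g≤X) (<-≤-trans (m<m+n (d * X) 1≤r) (≤-reflexive eq))))

    -- The launch [[0,0]] → [R,r] → [c,c] ⟲: if R = 0 then d ∣ r, so r = d and (k+1) ∣ g;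
    -- if R > 0 then [R,r] → [r,R] is an edge.
    launch-configuration : ∀ {w v} → k < g → Edge g k start w → Edge g k w v → Edge g k v v →
      EvenPivot g k v → OddPivot g k w ⊎ suc k ∣ g
    launch-configuration k<g (A , a , fromStart {R = R} {r} _ _ A≢0 _ s₁ s₂) (B , b , fromNode _ _ f₁ f₂)
                         (D , D′ , fromNode {P = c} _ _ l₁ l₂) refl = by-first-digit (toℕ R) refl
      where
      1≤r : 1 ≤ toℕ r
      1≤r = launch-moves {A} {a} {toℕ R} (toℕ r) A≢0 s₁ s₂
      merged : d * (b + B) + toℕ r ≡ d * D + toℕ R * g
      merged = two-step-equation {toℕ r} {toℕ c} {toℕ R} {b} {B} {D} f₁ f₂ (loop-equation {toℕ c} {D} {D′} l₁ l₂)
      by-first-digit : ∀ R′ → toℕ R ≡ R′ → OddPivot g k (node R r) ⊎ suc k ∣ g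
      by-first-digit zero R≡0 with divisor-extremes (s≤s⁻¹ (toℕ<n r)) d∣r
        where d∣r : d ∣ toℕ r
              d∣r = ∣m+n∣m⇒∣n (subst (d ∣_) (sym (trans merged (cong (λ x → d * D + x * g) R≡0)))
                                (∣m∣n⇒∣m+n (m∣m*n D) (d ∣0))) (m∣m*n (b + B))
      ... | inj₁ r≡0 = ⊥-elim (<-irrefl (sym r≡0) 1≤r)
      ... | inj₂ r≡d = inj₂ (launch-divides {A} {a} (subst (λ x → k * a + 0 ≡ A + x * g) r≡d s₁)
                                            (subst (λ x → k * A + x ≡ a + 0) R≡0 s₂))
      by-first-digit (suc R′) R≡ with excess {b + B} {D} {toℕ r} {R′} (<-trans (toℕ<n r) k<g) (subst (λ x → _ ≡ d * D + x * g) R≡ merged)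
      ... | X , eq = inj₁ (reverse-edge X 1≤r (subst (λ x → d * X + toℕ r ≡ x * g) (sym R≡) eq))

  YIso-refl : ∀ {g k} → YIso g k g k
  YIso-refl = record
    { to = λ u → u ; from = λ u → u ; to-in = λ _ iu → iu ; from-in = λ _ iu → iu
    ; from-to = λ _ _ → refl ; to-from = λ _ _ → refl
    ; edge = λ _ _ _ _ → ⇔-refl ; even = λ _ _ → ⇔-refl ; odd = λ _ _ → ⇔-refl
    }

  YIso-sym : ∀ {g k g′ k′} → YIso g k g′ k′ → YIso g′ k′ g k
  YIso-sym {g} {k} {g′} {k′} I = record
    { to      = from
    ; from    = to
    ; to-in   = from-in
    ; from-in = to-in
    ; from-to = to-from
    ; to-from = from-to
    ; edge    = λ u v iu iv → ⇔-trans (reindex (Edge g′ k′) (sym (to-from u iu)) (sym (to-from v iv)))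
                                      (⇔-sym (edge (from u) (from v) (from-in u iu) (from-in v iv)))
    ; even    = λ u iu → ⇔-trans (reindex₁ (EvenPivot g′ k′) (sym (to-from u iu)))
                                 (⇔-sym (even (from u) (from-in u iu)))
    ; odd     = λ u iu → ⇔-trans (reindex₁ (OddPivot g′ k′) (sym (to-from u iu)))
                                 (⇔-sym (odd (from u) (from-in u iu)))
    }
    where open YIso I

  last-edge : ∀ {g k u v} → Path g k u v → u ≡ v ⊎ ∃ λ y → Path g k u y × Edge g k y v
  last-edge ε = inj₁ refl
  last-edge (e ◅ es) with last-edge es
  ... | inj₁ refl          = inj₂ (_ , ε , e)
  ... | inj₂ (y , π , e′) = inj₂ (y , e ◅ π , e′)

  -- The start is the only node of a Young graph without incoming edges, so isomorphisms fix it.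
  iso-reflects-start : ∀ {g k g′ k′} (I : YIso g k g′ k′) {x} → InY g k x → YIso.to I x ≡ start → x ≡ start
  iso-reflects-start I {start} _ _ = refl
  iso-reflects-start {g} {k} {g′} {k′} I {node P p} ix@(π , v , ρ , pivot) to-x≡start with last-edge π
  ... | inj₂ (y , π′ , e) with subst (Edge g′ k′ (YIso.to I y)) to-x≡start
                                     (Equivalence.to (YIso.edge I y (node P p) (π′ , v , e ◅ ρ , pivot) ix) e)
  ...   | _ , _ , ()

  -- A Young graph isomorphic to one with (k′+1) ∣ g′ has (k+1) ∣ g: the launch, climb and top
  -- loop of the model transfer, while the start of the climb is still no odd pivot.
  iso-standard⇒divisible : ∀ e {g} e′ m′ → suc (suc e) < g →
    YIso g (suc (suc e)) (Standard.g e′ m′) (Standard.k e′ m′) → suc (suc (suc e)) ∣ g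
  iso-standard⇒divisible e {g} e′ m′ k<g I =
    fromInj₂ (λ odd → ⊥-elim (climb-not-odd odd))
      (Launch.launch-configuration e g k<g launched (transfer climb) (transfer crest) top-even)
    where
    module S = Standard e′ m′
    open YIso I using (from; from-in; to-from)
    I⁻¹ : YIso (Standard.g e′ m′) (Standard.k e′ m′) g (suc (suc e))
    I⁻¹ = YIso-sym I
    transfer : ∀ {c c′} → Step c c′ → Edge g (suc (suc e)) (from (S.embed c)) (from (S.embed c′))
    transfer {c} {c′} s = Equivalence.to
      (YIso.edge I⁻¹ (S.embed c) (S.embed c′) (S.corner-inY c) (S.corner-inY c′)) (S.step-edge s)
    start-fixed : from start ≡ start
    start-fixed = iso-reflects-start I (from-in start (S.corner-inY origin)) (to-from start (S.corner-inY origin))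
    climb : Step ⟨ false , true ⟩ ⟨ true , true ⟩
    climb = turn (λ ())
    crest : Step ⟨ true , true ⟩ ⟨ true , true ⟩
    crest = turn (λ ())
    launched : Edge g (suc (suc e)) start (from (S.embed ⟨ false , true ⟩))
    launched = subst (λ s → Edge g (suc (suc e)) s (from (S.embed ⟨ false , true ⟩))) start-fixed (transfer launch)
    top-even : EvenPivot g (suc (suc e)) (from (S.embed ⟨ true , true ⟩))
    top-even = Equivalence.to (YIso.even I⁻¹ (S.embed ⟨ true , true ⟩) (S.corner-inY ⟨ true , true ⟩)) refl
    climb-not-odd : ¬ OddPivot g (suc (suc e)) (from (S.embed ⟨ false , true ⟩))
    climb-not-odd odd with Equivalence.to (S.odd⇔ ⟨ false , true ⟩)
                             (Equivalence.from (YIso.odd I⁻¹ (S.embed ⟨ false , true ⟩) (S.corner-inY ⟨ false , true ⟩)) odd)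
    ... | turn no-zigzag = no-zigzag up-down

  divisible⇒iso : ∀ {g k g′ k′} → 2 ≤ k → k < g → suc k ∣ g → 2 ≤ k′ → k′ < g′ → suc k′ ∣ g′ →
    YIso g k g′ k′
  divisible⇒iso (s≤s (s≤s z≤n)) () (divides zero refl) _ _ _
  divisible⇒iso _ _ (divides (suc _) refl) (s≤s (s≤s z≤n)) () (divides zero refl)
  divisible⇒iso {k = 2+ e} {k′ = 2+ e′} _ _ (divides (suc m) refl) _ _ (divides (suc m′) refl) =
    standard-iso e m e′ m′

  iso⇒divisible : ∀ {g k g′ k′} → 2 ≤ k → k < g → 2 ≤ k′ → k′ < g′ → suc k′ ∣ g′ →
    YIso g k g′ k′ → suc k ∣ g
  iso⇒divisible _ _ (s≤s (s≤s z≤n)) () (divides zero refl) _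
  iso⇒divisible {k = 2+ e} {k′ = 2+ e′} (s≤s (s≤s z≤n)) k<g (s≤s (s≤s z≤n)) _ (divides (suc m′) refl) I =
    iso-standard⇒divisible e e′ m′ k<g I

  divisible-class : ∀ {g k g′ k′} → 2 ≤ k → k < g → 2 ≤ k′ → k′ < g′ → suc k′ ∣ g′ →
    YIso g k g′ k′ ⇔ suc k ∣ g
  divisible-class 2≤k k<g 2≤k′ k′<g′ k′+1∣g′ =
    mk⇔ (iso⇒divisible 2≤k k<g 2≤k′ k′<g′ k′+1∣g′) (λ k+1∣g → divisible⇒iso 2≤k k<g k+1∣g 2≤k′ k′<g′ k′+1∣g′)

  1089-graph⇔divisible : ∀ {g k} → 2 ≤ k → k < g → YIso g k 10 9 ⇔ suc k ∣ g
  1089-graph⇔divisible 2≤k k<g = divisible-class 2≤k k<g (s≤s (s≤s z≤n)) (n<1+n 9) (divides 1 refl)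

open YoungGraphs using (YIso-refl; YIso-sym; iso⇒divisible; divisible-class; 1089-graph⇔divisible)

open import Defs
open import Data.Nat using (ℕ; _≤_; _<_)
open import Data.Integer using (ℤ; +_)
open import Data.Integer.Divisibility using (_∣_)
open import Data.Product using (Σ; _,_)
open import Function.Bundles using (_⇔_; mk⇔; Equivalence)
import Data.Nat as ℕ
import Data.Nat.Properties as ℕ
import Data.Nat.Divisibility as ℕ

-- Divisibility of integers is that of their absolute values, so ℕ-divisibility proofs apply.
corollary5 : ∀ (g₀ k₀ : ℕ) → 2 ≤ k₀ → k₀ < g₀ →
    (Σ (ℕ → ℤ) (λ f → ∀ (g k : ℕ) → 2 ≤ k → k < g →
        (YIso g k g₀ k₀ ⇔ f k ∣ + g)))
    ⇔ YIso g₀ k₀ 10 9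
corollary5 g₀ k₀ 2≤k₀ k₀<g₀ = mk⇔ forward backward
  where
  forward : Σ (ℕ → ℤ) (λ f → ∀ (g k : ℕ) → 2 ≤ k → k < g → (YIso g k g₀ k₀ ⇔ f k ∣ + g)) →
    YIso g₀ k₀ 10 9
  forward (f , class) = Equivalence.from (1089-graph⇔divisible 2≤k₀ k₀<g₀) k₀+1∣g₀
    where
    G : ℕ
    G = g₀ ℕ.* ℕ.suc k₀
    k₀<G : k₀ < G
    k₀<G = ℕ.<-≤-trans k₀<g₀ (ℕ.m≤m*n g₀ (ℕ.suc k₀))
    f∣g₀ : f k₀ ∣ + g₀
    f∣g₀ = Equivalence.to (class g₀ k₀ 2≤k₀ k₀<g₀) YIso-refl
    Y[G]≅Y[g₀] : YIso G k₀ g₀ k₀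
    Y[G]≅Y[g₀] = Equivalence.from (class G k₀ 2≤k₀ k₀<G) (ℕ.∣-trans f∣g₀ (ℕ.m∣m*n (ℕ.suc k₀)))
    k₀+1∣g₀ : ℕ.suc k₀ ℕ.∣ g₀
    k₀+1∣g₀ = iso⇒divisible 2≤k₀ k₀<g₀ 2≤k₀ k₀<G (ℕ.n∣m*n g₀) (YIso-sym Y[G]≅Y[g₀])
  backward : YIso g₀ k₀ 10 9 →
    Σ (ℕ → ℤ) (λ f → ∀ (g k : ℕ) → 2 ≤ k → k < g → (YIso g k g₀ k₀ ⇔ f k ∣ + g))
  backward I = (λ k → + ℕ.suc k) , λ g k 2≤k k<g → divisible-class 2≤k k<g 2≤k₀ k₀<g₀ k₀+1∣g₀
    where
    k₀+1∣g₀ : ℕ.suc k₀ ℕ.∣ g₀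
    k₀+1∣g₀ = Equivalence.to (1089-graph⇔divisible 2≤k₀ k₀<g₀) I
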